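{- Let $G$ be a finite simple graph with $n$ vertices and $m$ edges. If $G$ has a DET:OLD set, then $m \ge \left\lceil \frac{3n - \lfloor n/2\rfloor}{2}\right\rceil$.
   Context: For a graph $G$ and $v\in V(G)$, $N(v)$ is the open neighborhood of $v$. For $S\subseteq V(G)$ write $N_S(v)=N(v)\cap S$. A set $S\subseteq V(G)$ is a DET:OLD set of $G$ if (1) every vertex $v\in V(G)$ satisfies $|N_S(v)|\ge 2$, and (2) every pair of distinct vertices $u,v\in V(G)$ satisfies $|N_S(u)\setminus N_S(v)|\ge 2$ or $|N_S(v)\setminus N_S(u)|\ge 2$. "$G$ has a DET:OLD set" means some $S\subseteq V(G)$ is a DET:OLD set of $G$. -}

module Defs where

open import Data.Nat using (ℕ; zero; suc; _+_)
open import Data.Fin using (Fin; zero; suc; _<_; _<?_)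
open import Data.Bool using (Bool; true; false; T)
open import Data.Bool.Properties using (T?)
open import Data.Product using (_×_; Σ)
open import Data.Sum using (_⊎_)
open import Relation.Binary.PropositionalEquality using (_≡_)
import Data.Nat
open import Relation.Nullary using (¬_; Dec; yes; no)
open import Relation.Nullary.Decidable using (_×-dec_; ¬?)

record Graph (n : ℕ) : Set₁ where
  field
    Adj     : Fin n → Fin n → Set
    adj?    : (u v : Fin n) → Dec (Adj u v)
    symm    : ∀ {u v} → Adj u v → Adj v u
    irrefl  : ∀ {u} → ¬ Adj u u

count : ∀ {n} {P : Fin n → Set} → ((i : Fin n) → Dec (P i)) → ℕ
count {zero}  P? = 0
count {suc n} P? with P? zero
... | yes _ = suc (count (λ i → P? (suc i)))
... | no  _ = count (λ i → P? (suc i))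

sumFin : ∀ {n} → (Fin n → ℕ) → ℕ
sumFin {zero}  f = 0
sumFin {suc n} f = f zero + sumFin (λ i → f (suc i))

VSet : ℕ → Set
VSet n = Fin n → Bool

module _ {n : ℕ} (G : Graph n) where
  open Graph G

  -- m = |E(G)|: unordered pairs {u,v} of adjacent vertices, counted as u < v
  edgeCount : ℕ
  edgeCount = sumFin (λ u → count (λ v → (u <? v) ×-dec adj? u v))

  nbhdSize : VSet n → Fin n → ℕ
  nbhdSize S v = count (λ w → adj? v w ×-dec T? (S w))

  diffSize : VSet n → Fin n → Fin n → ℕ
  diffSize S u v = count (λ w → (adj? u w ×-dec T? (S w)) ×-dec ¬? (adj? v w ×-dec T? (S w)))

  record IsDETOLD (S : VSet n) : Set where
    field
      dom  : ∀ v → 2 Data.Nat.≤ nbhdSize S v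
      sep  : ∀ u v → ¬ u ≡ v → (2 Data.Nat.≤ diffSize S u v) ⊎ (2 Data.Nat.≤ diffSize S v u)

  HasDETOLD : Set
  HasDETOLD = Σ (VSet n) IsDETOLD

{-# OPTIONS --safe #-}
module Submission where

-- Every vertex has at least two S-neighbours, so it has degree at least 2, and a
-- vertex of degree exactly 2 has both of its neighbours in S.  Two degree-2
-- vertices with a common neighbour w therefore share w in their S-neighbourhoods
-- of size 2, so they differ in at most one S-neighbour and cannot be separated:
-- every vertex has at most one degree-2 neighbour.  Double counting the pairs
-- (w, v) with v a degree-2 neighbour of w gives 2k ≤ n for the number k of
-- degree-2 vertices, so 2m = Σ deg ≥ 3n − k ≥ 3n − ⌊n/2⌋.

open import Defs
open import Data.Bool using (T)
open import Data.Bool.Properties using (T?)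
open import Data.Empty using (⊥-elim)
open import Data.Fin using (Fin; zero; suc; _<?_) renaming (_<_ to _<ᶠ_)
open import Data.Fin.Properties using (0≢1+n; suc-injective; <-cmp; <-asym) renaming (_≟_ to _≟ᶠ_)
open import Data.Nat using (ℕ; zero; suc; _+_; _*_; _∸_; _≤_; _<_; z≤n; s≤s; _≟_; ⌊_/2⌋; ⌈_/2⌉)
open import Data.Nat.Properties
  using ( +-commutativeSemigroup; +-comm; +-identityʳ; *-identityʳ; +-mono-≤; *-comm; *-zeroʳ
        ; ≤-refl; ≤-reflexive; ≤-trans; ≤-antisym; ≤⇒≯; ≤∧≢⇒<; m≤m+n; m≤n⇒m≤1+n; ∸-monoʳ-≤; m≤n+o⇒m∸n≤o
        ; ⌊n/2⌋-mono; ⌈n/2⌉-mono; n≡⌊n+n/2⌋; n≡⌈n+n/2⌉; module ≤-Reasoning )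
open import Algebra.Properties.CommutativeSemigroup +-commutativeSemigroup using (interchange)
open import Data.Product using (_×_; _,_; proj₁; proj₂)
open import Data.Sum using (_⊎_; inj₁; inj₂; [_,_])
open import Function using (_∘_)
open import Relation.Binary.Definitions using (tri<; tri≈; tri>)
open import Relation.Binary.PropositionalEquality using (_≡_; refl; sym; trans; cong; cong₂; subst; module ≡-Reasoning)
open import Relation.Nullary using (¬_; Dec; yes; no)
open import Relation.Nullary.Decidable using (_×-dec_; ¬?)

private
  variable
    n m : ℕ
    A B C : Set
    P Q R : Fin n → Set

indicator : Dec A → ℕ
indicator (yes _) = 1
indicator (no _)  = 0

indicator-yes : A → (a? : Dec A) → indicator a? ≡ 1
indicator-yes a (yes _) = refl
indicator-yes a (no ¬a) = ⊥-elim (¬a a)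

indicator-no : ¬ A → (a? : Dec A) → indicator a? ≡ 0
indicator-no ¬a (yes a) = ⊥-elim (¬a a)
indicator-no ¬a (no _)  = refl

indicator-disjoint-⊎ : (a? : Dec A) (b? : Dec B) (c? : Dec C) →
  (A → B ⊎ C) → (B ⊎ C → A) → ¬ (B × C) →
  indicator a? ≡ indicator b? + indicator c?
indicator-disjoint-⊎ a? (yes b) (yes c) _  _    disj = ⊥-elim (disj (b , c))
indicator-disjoint-⊎ a? (yes b) (no _)  _  from _    = indicator-yes (from (inj₁ b)) a?
indicator-disjoint-⊎ a? (no _)  (yes c) _  from _    = indicator-yes (from (inj₂ c)) a?
indicator-disjoint-⊎ a? (no ¬b) (no ¬c) to _    _    = indicator-no ([ ¬b , ¬c ] ∘ to) a?

sumFin-cong : {f g : Fin n → ℕ} → (∀ i → f i ≡ g i) → sumFin f ≡ sumFin g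
sumFin-cong {zero}  f≡g = refl
sumFin-cong {suc n} f≡g = cong₂ _+_ (f≡g zero) (sumFin-cong (f≡g ∘ suc))

sumFin-mono : {f g : Fin n → ℕ} → (∀ i → f i ≤ g i) → sumFin f ≤ sumFin g
sumFin-mono {zero}  f≤g = z≤n
sumFin-mono {suc n} f≤g = +-mono-≤ (f≤g zero) (sumFin-mono (f≤g ∘ suc))

sumFin-distrib-+ : (f g : Fin n → ℕ) → sumFin (λ i → f i + g i) ≡ sumFin f + sumFin g
sumFin-distrib-+ {zero}  f g = refl
sumFin-distrib-+ {suc n} f g = trans
  (cong (f zero + g zero +_) (sumFin-distrib-+ (f ∘ suc) (g ∘ suc)))
  (interchange (f zero) (g zero) (sumFin (f ∘ suc)) (sumFin (g ∘ suc)))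

sumFin-const : (c : ℕ) → sumFin {n} (λ _ → c) ≡ n * c
sumFin-const {zero}  c = refl
sumFin-const {suc n} c = cong (c +_) (sumFin-const {n} c)

sumFin-swap : (f : Fin n → Fin m → ℕ) →
  sumFin (λ i → sumFin (f i)) ≡ sumFin (λ j → sumFin (λ i → f i j))
sumFin-swap {zero}  {m} f = sym (trans (sumFin-const {m} 0) (*-zeroʳ m))
sumFin-swap {suc n} {m} f = trans
  (cong (sumFin (f zero) +_) (sumFin-swap (f ∘ suc)))
  (sym (sumFin-distrib-+ (f zero) (λ j → sumFin (λ i → f (suc i) j))))

count≡sumFin-indicator : (P? : ∀ i → Dec (P i)) → count P? ≡ sumFin (indicator ∘ P?)
count≡sumFin-indicator {zero}  P? = refl
count≡sumFin-indicator {suc n} P? with P? zero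
... | yes _ = cong suc (count≡sumFin-indicator (P? ∘ suc))
... | no  _ = count≡sumFin-indicator (P? ∘ suc)

count-none : (P? : ∀ i → Dec (P i)) → (∀ i → ¬ P i) → count P? ≡ 0
count-none {zero}  P? none = refl
count-none {suc n} P? none with P? zero
... | yes p = ⊥-elim (none zero p)
... | no  _ = count-none (P? ∘ suc) (none ∘ suc)

count≤1 : (P? : ∀ i → Dec (P i)) → (∀ i j → P i → P j → i ≡ j) → count P? ≤ 1
count≤1 {zero}  P? unique = z≤n
count≤1 {suc n} P? unique with P? zero
... | yes p = s≤s (≤-reflexive (count-none (P? ∘ suc) (λ i q → 0≢1+n (unique zero (suc i) p q))))
... | no  _ = count≤1 (P? ∘ suc) (λ i j p q → suc-injective (unique (suc i) (suc j) p q))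

count-mono : (P? : ∀ i → Dec (P i)) (Q? : ∀ i → Dec (Q i)) →
  (∀ i → P i → Q i) → count P? ≤ count Q?
count-mono {zero}  P? Q? P⇒Q = z≤n
count-mono {suc n} P? Q? P⇒Q with P? zero | Q? zero
... | yes p | no ¬q = ⊥-elim (¬q (P⇒Q zero p))
... | yes _ | yes _ = s≤s (count-mono (P? ∘ suc) (Q? ∘ suc) (P⇒Q ∘ suc))
... | no  _ | yes _ = m≤n⇒m≤1+n (count-mono (P? ∘ suc) (Q? ∘ suc) (P⇒Q ∘ suc))
... | no  _ | no  _ = count-mono (P? ∘ suc) (Q? ∘ suc) (P⇒Q ∘ suc)

count-< : (P? : ∀ i → Dec (P i)) (Q? : ∀ i → Dec (Q i)) →
  (∀ i → P i → Q i) → ∀ w → Q w → ¬ P w → count P? < count Q?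
count-< {suc n} P? Q? P⇒Q w qw ¬pw with P? zero | Q? zero | w
... | yes p | no ¬q | _     = ⊥-elim (¬q (P⇒Q zero p))
... | yes p | yes _ | zero  = ⊥-elim (¬pw p)
... | no  _ | no ¬q | zero  = ⊥-elim (¬q qw)
... | no  _ | yes _ | zero  = s≤s (count-mono (P? ∘ suc) (Q? ∘ suc) (P⇒Q ∘ suc))
... | yes _ | yes _ | suc w = s≤s (count-< (P? ∘ suc) (Q? ∘ suc) (P⇒Q ∘ suc) w qw ¬pw)
... | no  _ | yes _ | suc w = m≤n⇒m≤1+n (count-< (P? ∘ suc) (Q? ∘ suc) (P⇒Q ∘ suc) w qw ¬pw)
... | no  _ | no  _ | suc w = count-< (P? ∘ suc) (Q? ∘ suc) (P⇒Q ∘ suc) w qw ¬pw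

count-cong : (P? : ∀ i → Dec (P i)) (Q? : ∀ i → Dec (Q i)) →
  (∀ i → P i → Q i) → (∀ i → Q i → P i) → count P? ≡ count Q?
count-cong P? Q? P⇒Q Q⇒P = ≤-antisym (count-mono P? Q? P⇒Q) (count-mono Q? P? Q⇒P)

count-disjoint-⊎ : (P? : ∀ i → Dec (P i)) (Q? : ∀ i → Dec (Q i)) (R? : ∀ i → Dec (R i)) →
  (∀ i → P i → Q i ⊎ R i) → (∀ i → Q i ⊎ R i → P i) → (∀ i → ¬ (Q i × R i)) →
  count P? ≡ count Q? + count R?
count-disjoint-⊎ P? Q? R? to from disj = begin
  count P?
    ≡⟨ count≡sumFin-indicator P? ⟩
  sumFin (indicator ∘ P?)
    ≡⟨ sumFin-cong (λ i → indicator-disjoint-⊎ (P? i) (Q? i) (R? i) (to i) (from i) (disj i)) ⟩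
  sumFin (λ i → indicator (Q? i) + indicator (R? i))
    ≡⟨ sumFin-distrib-+ (indicator ∘ Q?) (indicator ∘ R?) ⟩
  sumFin (indicator ∘ Q?) + sumFin (indicator ∘ R?)
    ≡⟨ sym (cong₂ _+_ (count≡sumFin-indicator Q?) (count≡sumFin-indicator R?)) ⟩
  count Q? + count R? ∎
  where open ≡-Reasoning

sumFin-count-swap : {R : Fin n → Fin m → Set} (R? : ∀ i j → Dec (R i j)) →
  sumFin (λ i → count (R? i)) ≡ sumFin (λ j → count (λ i → R? i j))
sumFin-count-swap R? = begin
  sumFin (λ i → count (R? i))                      ≡⟨ sumFin-cong (λ i → count≡sumFin-indicator (R? i)) ⟩
  sumFin (λ i → sumFin (λ j → indicator (R? i j))) ≡⟨ sumFin-swap (λ i j → indicator (R? i j)) ⟩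
  sumFin (λ j → sumFin (λ i → indicator (R? i j))) ≡⟨ sym (sumFin-cong (λ j → count≡sumFin-indicator (λ i → R? i j))) ⟩
  sumFin (λ j → count (λ i → R? i j))              ∎
  where open ≡-Reasoning

module _ {n : ℕ} (G : Graph n) where
  open Graph G

  degree : Fin n → ℕ
  degree v = count (adj? v)

  handshake : sumFin degree ≡ edgeCount G + edgeCount G
  handshake = begin
    sumFin degree
      ≡⟨ sumFin-cong orient ⟩
    sumFin (λ u → count (forward u) + count (backward u))
      ≡⟨ sumFin-distrib-+ (count ∘ forward) (count ∘ backward) ⟩
    edgeCount G + sumFin (λ u → count (backward u))
      ≡⟨ cong (edgeCount G +_) (sumFin-count-swap backward) ⟩
    edgeCount G + edgeCount G ∎
    where
    open ≡-Reasoning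
    Forward Backward : Fin n → Fin n → Set
    Forward  u v = u <ᶠ v × Adj u v
    Backward u v = v <ᶠ u × Adj v u

    forward : ∀ u v → Dec (Forward u v)
    forward  u v = (u <? v) ×-dec adj? u v
    backward : ∀ u v → Dec (Backward u v)
    backward u v = (v <? u) ×-dec adj? v u

    orient : ∀ u → degree u ≡ count (forward u) + count (backward u)
    orient u = count-disjoint-⊎ (adj? u) (forward u) (backward u) split join
      (λ v ((u<v , _) , (v<u , _)) → <-asym u<v v<u)
      where
      split : ∀ v → Adj u v → Forward u v ⊎ Backward u v
      split v uv with <-cmp u v
      ... | tri< u<v _ _    = inj₁ (u<v , uv)
      ... | tri≈ _ refl _   = ⊥-elim (irrefl uv)
      ... | tri> _ _ v<u    = inj₂ (v<u , symm uv)
      join : ∀ v → Forward u v ⊎ Backward u v → Adj u v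
      join v = [ proj₂ , symm ∘ proj₂ ]

  double-count-neighbours : {D : Fin n → Set} (D? : ∀ v → Dec (D v)) →
    sumFin (λ w → count (λ v → adj? w v ×-dec D? v)) ≡ sumFin (λ v → indicator (D? v) * degree v)
  double-count-neighbours D? = trans
    (sumFin-count-swap (λ w v → adj? w v ×-dec D? v))
    (sumFin-cong per-vertex)
    where
    per-vertex : ∀ v → count (λ w → adj? w v ×-dec D? v) ≡ indicator (D? v) * degree v
    per-vertex v with D? v
    ... | yes d = trans (count-cong _ (adj? v) (λ w → symm ∘ proj₁) (λ w vw → symm vw , d))
                        (sym (+-identityʳ (degree v)))
    ... | no ¬d = count-none (λ w → adj? w v ×-dec no ¬d) (λ w → ¬d ∘ proj₂)

  degree≡2? : ∀ v → Dec (degree v ≡ 2)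
  degree≡2? v = degree v ≟ 2

  nbhdSize≤degree : (S : VSet n) → ∀ v → nbhdSize G S v ≤ degree v
  nbhdSize≤degree S v = count-mono _ (adj? v) (λ w → proj₁)

module _ {n : ℕ} {G : Graph n} {S : VSet n} (det : IsDETOLD G S) where
  open Graph G
  open IsDETOLD det

  2≤degree : ∀ v → 2 ≤ degree G v
  2≤degree v = ≤-trans (dom v) (nbhdSize≤degree G S v)

  degree≡2⇒neighbour∈S : ∀ {a w} → degree G a ≡ 2 → Adj a w → T (S w)
  degree≡2⇒neighbour∈S {a} {w} da aw with T? (S w)
  ... | yes w∈S = w∈S
  ... | no  w∉S = ⊥-elim (≤⇒≯ (dom a) (subst (nbhdSize G S a <_) da
          (count-< (λ x → adj? a x ×-dec T? (S x)) (adj? a) (λ x → proj₁) w aw (w∉S ∘ proj₂))))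

  degree≡2⇒diffSize<2 : ∀ {a b w} → degree G a ≡ 2 → Adj a w → Adj b w → diffSize G S a b < 2
  degree≡2⇒diffSize<2 {a} {b} {w} da aw bw = subst (diffSize G S a b <_) da
    (count-< (λ x → (adj? a x ×-dec T? (S x)) ×-dec ¬? (adj? b x ×-dec T? (S x))) (adj? a)
             (λ x → proj₁ ∘ proj₁) w aw (λ (_ , w∉NSb) → w∉NSb (bw , degree≡2⇒neighbour∈S da aw)))

  degree≡2-common-neighbour⇒≡ : ∀ {w a b} → Adj w a → Adj w b →
    degree G a ≡ 2 → degree G b ≡ 2 → a ≡ b
  degree≡2-common-neighbour⇒≡ {a = a} {b} wa wb da db with a ≟ᶠ b
  ... | yes a≡b = a≡b
  ... | no  a≢b with sep a b a≢b
  ... | inj₁ 2≤diff = ⊥-elim (≤⇒≯ 2≤diff (degree≡2⇒diffSize<2 da (symm wa) (symm wb)))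
  ... | inj₂ 2≤diff = ⊥-elim (≤⇒≯ 2≤diff (degree≡2⇒diffSize<2 db (symm wb) (symm wa)))

  count-degree≡2-neighbours≤1 : ∀ w → count (λ v → adj? w v ×-dec degree≡2? G v) ≤ 1
  count-degree≡2-neighbours≤1 w = count≤1 (λ v → adj? w v ×-dec degree≡2? G v)
    (λ a b (wa , da) (wb , db) → degree≡2-common-neighbour⇒≡ wa wb da db)

  count-degree≡2-doubled≤n : count (degree≡2? G) + count (degree≡2? G) ≤ n
  count-degree≡2-doubled≤n = begin
    count (degree≡2? G) + count (degree≡2? G)
      ≡⟨ cong₂ _+_ (count≡sumFin-indicator (degree≡2? G)) (count≡sumFin-indicator (degree≡2? G)) ⟩
    sumFin (indicator ∘ degree≡2? G) + sumFin (indicator ∘ degree≡2? G)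
      ≡⟨ sym (sumFin-distrib-+ (indicator ∘ degree≡2? G) (indicator ∘ degree≡2? G)) ⟩
    sumFin (λ v → indicator (degree≡2? G v) + indicator (degree≡2? G v))
      ≡⟨ sumFin-cong doubled-indicator ⟩
    sumFin (λ v → indicator (degree≡2? G v) * degree G v)
      ≡⟨ sym (double-count-neighbours G (degree≡2? G)) ⟩
    sumFin (λ w → count (λ v → adj? w v ×-dec degree≡2? G v))
      ≤⟨ sumFin-mono count-degree≡2-neighbours≤1 ⟩
    sumFin {n} (λ _ → 1)
      ≡⟨ trans (sumFin-const {n} 1) (*-identityʳ n) ⟩
    n ∎
    where
    open ≤-Reasoning
    doubled-indicator : ∀ v → indicator (degree≡2? G v) + indicator (degree≡2? G v)
                              ≡ indicator (degree≡2? G v) * degree G v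
    doubled-indicator v with degree≡2? G v
    ... | yes d = sym (trans (+-identityʳ (degree G v)) d)
    ... | no  _ = refl

  3n≤sumFin-degree+count-degree≡2 : 3 * n ≤ sumFin (degree G) + count (degree≡2? G)
  3n≤sumFin-degree+count-degree≡2 = begin
    3 * n
      ≡⟨ trans (*-comm 3 n) (sym (sumFin-const {n} 3)) ⟩
    sumFin {n} (λ _ → 3)
      ≤⟨ sumFin-mono degree+indicator≥3 ⟩
    sumFin (λ v → degree G v + indicator (degree≡2? G v))
      ≡⟨ sumFin-distrib-+ (degree G) (indicator ∘ degree≡2? G) ⟩
    sumFin (degree G) + sumFin (indicator ∘ degree≡2? G)
      ≡⟨ cong (sumFin (degree G) +_) (sym (count≡sumFin-indicator (degree≡2? G))) ⟩
    sumFin (degree G) + count (degree≡2? G) ∎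
    where
    open ≤-Reasoning
    degree+indicator≥3 : ∀ v → 3 ≤ degree G v + indicator (degree≡2? G v)
    degree+indicator≥3 v with degree≡2? G v
    ... | yes d rewrite d = ≤-refl
    ... | no  d≢2 = ≤-trans (≤∧≢⇒< (2≤degree v) (d≢2 ∘ sym)) (m≤m+n (degree G v) 0)

⌈3n∸⌊n/2⌋/2⌉≤m : ∀ n m k → 3 * n ≤ (m + m) + k → k + k ≤ n → ⌈ 3 * n ∸ ⌊ n /2⌋ /2⌉ ≤ m
⌈3n∸⌊n/2⌋/2⌉≤m n m k 3n≤2m+k 2k≤n = begin
  ⌈ 3 * n ∸ ⌊ n /2⌋ /2⌉ ≤⟨ ⌈n/2⌉-mono (∸-monoʳ-≤ (3 * n) k≤⌊n/2⌋) ⟩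
  ⌈ 3 * n ∸ k /2⌉       ≤⟨ ⌈n/2⌉-mono (m≤n+o⇒m∸n≤o (3 * n) k (subst (3 * n ≤_) (+-comm (m + m) k) 3n≤2m+k)) ⟩
  ⌈ m + m /2⌉           ≡⟨ sym (n≡⌈n+n/2⌉ m) ⟩
  m                     ∎
  where
  open ≤-Reasoning
  k≤⌊n/2⌋ : k ≤ ⌊ n /2⌋
  k≤⌊n/2⌋ = subst (_≤ ⌊ n /2⌋) (sym (n≡⌊n+n/2⌋ k)) (⌊n/2⌋-mono 2k≤n)

theorem4 : (n : ℕ) (G : Graph n) → HasDETOLD G →
    ⌈ 3 * n ∸ ⌊ n /2⌋ /2⌉ ≤ edgeCount G
theorem4 n G (S , det) = ⌈3n∸⌊n/2⌋/2⌉≤m n (edgeCount G) (count (degree≡2? G))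
  (subst (λ σ → 3 * n ≤ σ + count (degree≡2? G)) (handshake G) (3n≤sumFin-degree+count-degree≡2 det))
  (count-degree≡2-doubled≤n det)
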